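{- Let $G$ be a connected graph. If there exist a positive integer $m$ and $(v,v')\in\mathcal{N}_m(G)$ such that $\eta(G)=\eta_m(v,v')$ and $N(v,m)\cup N(v',m)\neq V(G)$, then $\eta(G)\ge\mu(G)$.
   Context: Graphs are simple and connected; $d$ is the shortest-path distance. For a vertex $v$ and positive integer $m$: $N(v,m)=\{w: d(v,w)\le m\}$, $S(v,m)=\{w: d(v,w)=m\}$, $\partial N(v,m)=\{w\in S(v,m): d(w,V(G)\setminus N(v,m))=1\}$. Distinct $v,v'$ have equal $m$-boundary if $\partial N(v,m)=\partial N(v',m)\neq\emptyset$; $\mathcal{N}_m(G)$ is the set of such ordered pairs. For $(v,v')\in\mathcal{N}_m(G)$, $\eta_m(v,v')=|\{w\in N(v,m)\cup N(v',m): d(v,w)\neq d(v',w)\}|$; $\eta_m(G)=\min_{\mathcal{N}_m(G)}\eta_m(v,v')$, $\eta(G)=\min_m\eta_m(G)$ (over $m$ with $\mathcal{N}_m(G)\ne\emptyset$). A vertex separator is a set of vertices whose removal disconnects $G$. For distinct $v,v'$, a common separating subset of their $m$-spheres is a set $S\subseteq S(v,m)\cap S(v',m)$ which is a vertex separator such that some component of $G\setminus S$ contains neither $v$ nor $v'$. $\mathcal{P}_m(G)$ is the set of ordered pairs of distinct vertices whose $m$-spheres have a common separating subset. For $(v,v')\in\mathcal{P}_m(G)$, $S_m(v,v')$ is the union of all such subsets, $C_m^j$ ($j\in J$) the components of $G\setminus S_m(v,v')$ containing neither $v$ nor $v'$, $\mu_m(v,v')=|\{w\in V(G)\setminus\bigcup_jC_m^j: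 d(v,w)\neq d(v',w)\}|$; $\mu_m(G)=\min_{\mathcal{P}_m(G)}\mu_m(v,v')$, $\mu(G)=\min_m\mu_m(G)$ (minimum over empty set $=+\infty$). -}

module Defs where

open import Data.Nat using (ℕ; zero; suc; _≤_; _<_)
open import Data.Fin using (Fin)
open import Data.Fin.Subset using (Subset; _∈_; _∉_; ∣_∣)
open import Data.Product using (Σ; ∃; _×_; _,_)
open import Data.Sum using (_⊎_)
open import Relation.Nullary using (¬_)
open import Relation.Binary.PropositionalEquality using (_≡_; _≢_)
open import Function.Bundles using (_⇔_)

record Graph (n : ℕ) : Set₁ where
  field
    Adj    : Fin n → Fin n → Set
    sym    : ∀ {x y} → Adj x y → Adj y x
    irrefl : ∀ {x} → ¬ Adj x x
open Graph public

module _ {n : ℕ} (G : Graph n) where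

  data Walk : Fin n → Fin n → ℕ → Set where
    [] : ∀ {x} → Walk x x zero
    _∷_ : ∀ {x y z k} → Adj G x y → Walk y z k → Walk x z (suc k)

  Connected : Set
  Connected = ∀ x y → ∃ λ k → Walk x y k

  IsShortestPathDist : (Fin n → Fin n → ℕ) → Set
  IsShortestPathDist d =
    ∀ x y → Walk x y (d x y) × (∀ k → Walk x y k → d x y ≤ k)

  data ReachAvoid (S : Subset n) : Fin n → Fin n → Set where
    here : ∀ {x} → x ∉ S → ReachAvoid S x x
    step : ∀ {x y z} → x ∉ S → Adj G x y → ReachAvoid S y z → ReachAvoid S x z

  IsVertexSeparator : Subset n → Set
  IsVertexSeparator S = Σ (Fin n) λ x → Σ (Fin n) λ y →
    x ∉ S × y ∉ S × ¬ ReachAvoid S x y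

  module _ (d : Fin n → Fin n → ℕ) where

    InBall : Fin n → ℕ → Fin n → Set
    InBall v m w = d v w ≤ m

    InSphere : Fin n → ℕ → Fin n → Set
    InSphere v m w = d v w ≡ m

    -- w ∈ S(v,m) and d(w, V \ N(v,m)) = 1
    InBoundary : Fin n → ℕ → Fin n → Set
    InBoundary v m w = InSphere v m w ×
      (Σ (Fin n) λ u → ¬ InBall v m u × d w u ≡ 1)
      × (∀ u → ¬ InBall v m u → 1 ≤ d w u)

    -- (v,v') ∈ 𝒩_m(G)
    EqualBoundary : ℕ → Fin n → Fin n → Set
    EqualBoundary m v v' = v ≢ v'
      × (∀ w → InBoundary v m w ⇔ InBoundary v' m w)
      × (Σ (Fin n) λ w → InBoundary v m w)

    -- the set whose size is η_m(v,v')
    EtaSet : ℕ → Fin n → Fin n → Fin n → Set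
    EtaSet m v v' w = (InBall v m w ⊎ InBall v' m w) × d v w ≢ d v' w

    CommonSepSubset : ℕ → Fin n → Fin n → Subset n → Set
    CommonSepSubset m v v' S =
      (∀ w → w ∈ S → InSphere v m w × InSphere v' m w)
      × IsVertexSeparator S
      × (Σ (Fin n) λ x → x ∉ S × ¬ ReachAvoid S x v × ¬ ReachAvoid S x v')

    -- (v,v') ∈ 𝒫_m(G)
    InP : ℕ → Fin n → Fin n → Set
    InP m v v' = v ≢ v' × Σ (Subset n) (CommonSepSubset m v v')

    InSm : ℕ → Fin n → Fin n → Fin n → Set
    InSm m v v' w = Σ (Subset n) λ S → CommonSepSubset m v v' S × w ∈ S

    IsSm : ℕ → Fin n → Fin n → Subset n → Set
    IsSm m v v' Sm = ∀ w → w ∈ Sm ⇔ InSm m v v' w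

    -- w ∈ ⋃_j C_m^j : w ∉ S_m(v,v') and its component in G \ S_m(v,v')
    -- contains neither v nor v'
    InFarComponent : Subset n → Fin n → Fin n → Fin n → Set
    InFarComponent Sm v v' w = w ∉ Sm × ¬ ReachAvoid Sm w v × ¬ ReachAvoid Sm w v'

    -- the set whose size is μ_m(v,v'), given Sm = S_m(v,v')
    MuSet : Subset n → Fin n → Fin n → Fin n → Set
    MuSet Sm v v' w = ¬ InFarComponent Sm v v' w × d v w ≢ d v' w

HasCard : ∀ {n} → (Fin n → Set) → ℕ → Set
HasCard {n} P k = Σ (Subset n) λ X → (∀ w → w ∈ X ⇔ P w) × ∣ X ∣ ≡ k

module Submission where

-- Take m' = m, u = v, u' = v' and S = S(v,m) ∩ S(v',m). This S contains the
-- common boundary ∂N(v,m) = ∂N(v',m), and a path entering a ball from outside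
-- enters it at a boundary vertex, so every vertex outside N(v,m) ∪ N(v',m) is
-- cut off from v and v' by S; such a vertex exists by hypothesis, so S is a
-- common separating subset and S_m(v,v') = S. Conversely a vertex of either
-- ball that is not in S reaches its centre along a geodesic, whose later
-- vertices are strictly inside the ball. Hence the far components of G \ S are
-- exactly the vertices outside both balls, and μ_m(v,v') = η_m(v,v') = η(G).

open import Defs renaming (sym to Adj-sym)
open import Data.Nat using (ℕ; zero; suc; _≤_; _≟_; _≤?_; z≤n; s≤s; s≤s⁻¹)
open import Data.Nat.Properties using (≤-refl; ≤-reflexive; ≤-trans; ≤-antisym; n≤0⇒n≡0; n≤1+n; <⇒≢; ≰⇒>)
open import Data.Fin using (Fin)
open import Data.Fin.Properties using (¬∀⟶∃¬)
open import Data.Fin.Subset using (Subset; _∈_; _∉_)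
open import Data.Vec using (tabulate)
open import Data.Vec.Properties using (lookup∘tabulate; []=⇒lookup; lookup⇒[]=)
open import Data.Product using (Σ; ∃; _×_; _,_; proj₁; proj₂; map₁)
open import Data.Sum using (_⊎_; inj₁; inj₂)
open import Function using (_∘_)
open import Function.Bundles using (_⇔_; mk⇔; Equivalence)
open import Function.Construct.Composition using (_⇔-∘_)
open import Relation.Nullary using (¬_; yes; no; contradiction)
open import Relation.Nullary.Decidable using (isYes; toWitness; fromWitness; decidable-stable; _×-dec_; _⊎-dec_)
open import Relation.Unary using (Decidable)
open import Relation.Binary.PropositionalEquality using (_≡_; _≢_; refl; sym; trans; subst)
open import Data.Bool.Properties using (T-≡)

open Equivalence using (to; from)

fromDecidable : ∀ {n} {P : Fin n → Set} → Decidable P → Subset n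
fromDecidable P? = tabulate (isYes ∘ P?)

∈-fromDecidable : ∀ {n} {P : Fin n → Set} (P? : Decidable P) w →
                  w ∈ fromDecidable P? ⇔ P w
∈-fromDecidable P? w = mk⇔
  (λ w∈ → toWitness {a? = P? w} (from T-≡ (trans (sym (lookup∘tabulate _ w)) ([]=⇒lookup w∈))))
  (λ Pw → lookup⇒[]= w _ (trans (lookup∘tabulate _ w) (to T-≡ (fromWitness Pw))))

HasCard-resp-⇔ : ∀ {n} {P Q : Fin n → Set} {k} →
                 (∀ w → P w ⇔ Q w) → HasCard P k → HasCard Q k
HasCard-resp-⇔ P⇔Q (X , X⇔P , ∣X∣≡k) = X , (λ w → P⇔Q w ⇔-∘ X⇔P w) , ∣X∣≡k

module _ {n} (G : Graph n) where

  _∷ʳ_ : ∀ {x y z k} → Walk G x y k → Adj G y z → Walk G x z (suc k)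
  []      ∷ʳ a = a ∷ []
  (b ∷ p) ∷ʳ a = b ∷ (p ∷ʳ a)

  reverse : ∀ {x y k} → Walk G x y k → Walk G y x k
  reverse []      = []
  reverse (a ∷ p) = reverse p ∷ʳ Adj-sym G a

  Walk-0⇒≡ : ∀ {x y} → Walk G x y 0 → x ≡ y
  Walk-0⇒≡ [] = refl

  ReachAvoid-source∉ : ∀ {S x z} → ReachAvoid G S x z → x ∉ S
  ReachAvoid-source∉ (here x∉)     = x∉
  ReachAvoid-source∉ (step x∉ _ _) = x∉

  module _ {d : Fin n → Fin n → ℕ} (isDist : IsShortestPathDist G d) where

    geodesic : ∀ x y → Walk G x y (d x y)
    geodesic x y = proj₁ (isDist x y)

    d-minimal : ∀ {x y k} → Walk G x y k → d x y ≤ k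
    d-minimal {x} {y} = proj₂ (isDist x y) _

    d-refl : ∀ x → d x x ≡ 0
    d-refl x = n≤0⇒n≡0 (d-minimal [])

    d≡0⇒≡ : ∀ {x y} → d x y ≡ 0 → x ≡ y
    d≡0⇒≡ {x} {y} e = Walk-0⇒≡ (subst (Walk G x y) e (geodesic x y))

    ≢⇒1≤d : ∀ {x y} → x ≢ y → 1 ≤ d x y
    ≢⇒1≤d {x} {y} x≢y with d x y in e
    ... | zero  = contradiction (d≡0⇒≡ e) x≢y
    ... | suc _ = s≤s z≤n

    d-adj : ∀ {x y} → Adj G x y → d x y ≡ 1
    d-adj a = ≤-antisym (d-minimal (a ∷ [])) (≢⇒1≤d λ { refl → irrefl G a })

    d-step : ∀ c {x y} → Adj G x y → d c y ≤ suc (d c x)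
    d-step c {x} a = d-minimal (geodesic c x ∷ʳ a)

    geodesic-step : ∀ {c w k} → d c w ≡ suc k → ∃ λ y → Adj G w y × d c y ≡ k
    geodesic-step {c} {w} {k} e with reverse (subst (Walk G c w) e (geodesic c w))
    ... | _∷_ {y = y} a p = y , a , ≤-antisym (d-minimal (reverse p)) k≤dy
      where
        k≤dy : k ≤ d c y
        k≤dy = s≤s⁻¹ (subst (_≤ suc (d c y)) e (d-step c (Adj-sym G a)))

    centre∈ball : ∀ c m → InBall G d c m c
    centre∈ball c m = subst (_≤ m) (sym (d-refl c)) z≤n

    ∉ball⇒∉sphere : ∀ {c m w} → ¬ InBall G d c m w → ¬ InSphere G d c m w
    ∉ball⇒∉sphere w∉ e = w∉ (≤-reflexive e)

    edge-leaving-ball⇒boundary : ∀ {c m x y} → InBall G d c m y → ¬ InBall G d c m x →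
                                 Adj G y x → InBoundary G d c m y
    edge-leaving-ball⇒boundary {c} {m} {x} {y} y∈ x∉ a =
        ≤-antisym y∈ m≤dy
      , (x , x∉ , d-adj a)
      , (λ u u∉ → ≢⇒1≤d λ { refl → u∉ y∈ })
      where
        m≤dy : m ≤ d c y
        m≤dy = s≤s⁻¹ (≤-trans (≰⇒> x∉) (d-step c a))

    boundary-separates-ball : ∀ {c m S x z} → (∀ w → InBoundary G d c m w → w ∈ S) →
                              ¬ InBall G d c m x → InBall G d c m z → ¬ ReachAvoid G S x z
    boundary-separates-ball ∂⊆S x∉ z∈ (here _) = x∉ z∈
    boundary-separates-ball {c} {m} ∂⊆S x∉ z∈ (step {y = y} _ a r) with d c y ≤? m
    ... | no y∉ = boundary-separates-ball ∂⊆S y∉ z∈ r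
    ... | yes y∈ = ReachAvoid-source∉ r (∂⊆S y (edge-leaving-ball⇒boundary y∈ x∉ (Adj-sym G a)))

    ball-reaches-centre : ∀ {c m S w} → (∀ u → u ∈ S → InSphere G d c m u) →
                          InBall G d c m w → w ∉ S → ReachAvoid G S w c
    ball-reaches-centre {c} {m} {S} S⊆sphere w∈ = go _ refl w∈
      where
        go : ∀ k {w} → d c w ≡ k → k ≤ m → w ∉ S → ReachAvoid G S w c
        go zero    e _   w∉ = subst (ReachAvoid G S _) (sym (d≡0⇒≡ e)) (here w∉)
        go (suc k) e k<m w∉ with geodesic-step e
        ... | y , a , dy = step w∉ a (go k dy (≤-trans (n≤1+n k) k<m)
                                         λ y∈ → <⇒≢ k<m (trans (sym dy) (S⊆sphere y y∈)))

    module _ (m : ℕ) (v v' : Fin n) where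

      commonSphere : Subset n
      commonSphere = fromDecidable λ w → (d v w ≟ m) ×-dec (d v' w ≟ m)

      ∈commonSphere : ∀ w → w ∈ commonSphere ⇔ (InSphere G d v m w × InSphere G d v' m w)
      ∈commonSphere = ∈-fromDecidable _

      InEitherBall : Fin n → Set
      InEitherBall w = InBall G d v m w ⊎ InBall G d v' m w

      InEitherBall? : Decidable InEitherBall
      InEitherBall? w = (d v w ≤? m) ⊎-dec (d v' w ≤? m)

      inEitherBall⇒¬far : ∀ {w} → InEitherBall w → ¬ InFarComponent G d commonSphere v v' w
      inEitherBall⇒¬far (inj₁ w∈) (w∉S , ¬w→v , _) =
        ¬w→v (ball-reaches-centre (λ u → proj₁ ∘ to (∈commonSphere u)) w∈ w∉S)
      inEitherBall⇒¬far (inj₂ w∈) (w∉S , _ , ¬w→v') =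
        ¬w→v' (ball-reaches-centre (λ u → proj₂ ∘ to (∈commonSphere u)) w∈ w∉S)

      commonSphere-isSm : CommonSepSubset G d m v v' commonSphere → IsSm G d m v v' commonSphere
      commonSphere-isSm sep w = mk⇔ (λ w∈ → _ , sep , w∈)
                                    (λ { (_ , (S⊆spheres , _) , w∈S) → from (∈commonSphere w) (S⊆spheres w w∈S) })

      module _ (∂-eq : ∀ w → InBoundary G d v m w ⇔ InBoundary G d v' m w) where

        ¬inEitherBall⇒far : ∀ {w} → ¬ InEitherBall w → InFarComponent G d commonSphere v v' w
        ¬inEitherBall⇒far {w} w∉ =
            (λ w∈S → ∉ball⇒∉sphere (w∉ ∘ inj₁) (proj₁ (to (∈commonSphere w) w∈S)))
          , boundary-separates-ball ∂v⊆S  (w∉ ∘ inj₁) (centre∈ball v m)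
          , boundary-separates-ball ∂v'⊆S (w∉ ∘ inj₂) (centre∈ball v' m)
          where
            ∂v⊆S : ∀ u → InBoundary G d v m u → u ∈ commonSphere
            ∂v⊆S u b = from (∈commonSphere u) (proj₁ b , proj₁ (to (∂-eq u) b))
            ∂v'⊆S : ∀ u → InBoundary G d v' m u → u ∈ commonSphere
            ∂v'⊆S u b = from (∈commonSphere u) (proj₁ (from (∂-eq u) b) , proj₁ b)

        EtaSet⇔MuSet : ∀ w → EtaSet G d m v v' w ⇔ MuSet G d commonSphere v v' w
        EtaSet⇔MuSet w = mk⇔ (map₁ inEitherBall⇒¬far)
          (map₁ λ ¬far → decidable-stable (InEitherBall? w) (¬far ∘ ¬inEitherBall⇒far))

        commonSphere-separates : 1 ≤ m → ∀ {x} → ¬ InEitherBall x →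
                                 CommonSepSubset G d m v v' commonSphere
        commonSphere-separates 1≤m {x} x∉ =
            (λ w → to (∈commonSphere w))
          , (x , v , proj₁ x-far , v∉S , proj₁ (proj₂ x-far))
          , (x , x-far)
          where
            x-far : InFarComponent G d commonSphere v v' x
            x-far = ¬inEitherBall⇒far x∉
            v∉S : v ∉ commonSphere
            v∉S v∈ = <⇒≢ 1≤m (trans (sym (d-refl v)) (proj₁ (to (∈commonSphere v) v∈)))

proposition2p14 : ∀ {n} (G : Graph n) (d : Fin n → Fin n → ℕ)
    → Connected G → IsShortestPathDist G d
    → (m : ℕ) → 1 ≤ m → (v v' : Fin n) → EqualBoundary G d m v v'
    → (k : ℕ) → HasCard (EtaSet G d m v v') k
    → (∀ m' → 1 ≤ m' → ∀ u u' → EqualBoundary G d m' u u'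
         → ∀ k' → HasCard (EtaSet G d m' u u') k' → k ≤ k')
    → ¬ (∀ w → InBall G d v m w ⊎ InBall G d v' m w)
    → Σ ℕ λ m' → 1 ≤ m' × Σ (Fin n) λ u → Σ (Fin n) λ u' → InP G d m' u u'
        × Σ (Subset n) λ Sm → IsSm G d m' u u' Sm
        × Σ ℕ λ j → HasCard (MuSet G d Sm u u') j × j ≤ k
proposition2p14 G d _ isDist m 1≤m v v' (v≢v' , ∂-eq , _) k η-card _ ¬covered =
  m , 1≤m , v , v' , (v≢v' , S , sep) , S , commonSphere-isSm G isDist m v v' sep ,
  k , HasCard-resp-⇔ (EtaSet⇔MuSet G isDist m v v' ∂-eq) η-card , ≤-refl
  where
    S : Subset _
    S = commonSphere G isDist m v v'
    x-outside : ∃ λ x → ¬ InEitherBall G isDist m v v' x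
    x-outside = ¬∀⟶∃¬ _ _ (InEitherBall? G isDist m v v') ¬covered
    sep : CommonSepSubset G d m v v' S
    sep = commonSphere-separates G isDist m v v' ∂-eq 1≤m (proj₂ x-outside)
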